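{- Let $m$ be a nonnegative integer, let $\{a_n\}_{n\ge0}$ be a sequence of real (or complex) numbers and let $\varepsilon\in\{1,-1\}$. Then $$\sum_{k=0}^n\binom{n-m-1}{k}(-1)^{n-k}a_{n-k}=\varepsilon a_n\quad(n=0,1,2,\ldots)$$ holds if and only if both $$\sum_{k=0}^n\binom nk\frac{a_k}{\binom mk}=\varepsilon(-1)^n\frac{a_n}{\binom mn}\quad(n=0,1,\ldots,m)$$ and $$\sum_{k=0}^n\binom nk(-1)^ka_{k+m+1}=\varepsilon(-1)^{m+1}a_{n+m+1}\quad(n=0,1,2,\ldots)$$ hold.
   Context: For real $x$ and a nonnegative integer $k$, $\binom xk=x(x-1)\cdots(x-k+1)/k!$ (with $\binom x0=1$). -}

module Defs where

open import Algebra.Bundles using (CommutativeRing)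
open import Data.Nat using (ℕ; zero; suc; _!)
open import Relation.Binary.PropositionalEquality using (_≢_)

-- Everything is stated over an arbitrary commutative ring R in which every
-- positive integer is invertible (e.g. ℝ or ℂ).
module WithRing {c ℓ} (R : CommutativeRing c ℓ) where
  open CommutativeRing R

  ι : ℕ → Carrier
  ι zero = 0#
  ι (suc n) = 1# + ι n

  negOnePow : ℕ → Carrier
  negOnePow zero = 1#
  negOnePow (suc n) = (- 1#) * negOnePow n

  ff : Carrier → ℕ → Carrier
  ff x zero = 1#
  ff x (suc k) = ff x k * (x - ι k)

  IsNatInverse : (ℕ → Carrier) → Set ℓ
  IsNatInverse invN = ∀ n → n ≢ 0 → ι n * invN n ≈ 1#

  binom : (ℕ → Carrier) → Carrier → ℕ → Carrier
  binom invN x k = ff x k * invN (k !)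

  sumTo : ℕ → (ℕ → Carrier) → Carrier
  sumTo zero f = f 0
  sumTo (suc n) f = sumTo n f + f (suc n)

module Submission where

-- Write  L(n) = Σ_k binom(n-m-1,k) (-1)^(n-k) a_(n-k).
-- The upper argument n-m-1 is a natural number p when n = p+m+1, and the negative
-- integer -(m-n+1) when n ≤ m; in both cases binom(·,k) is an ordinary binomial
-- coefficient up to sign, and the proof compares L(n) with the two other sums term
-- by term:
--   * n = p+m+1:  only k ≤ p contributes and, reflecting k ↦ p-k,
--                 L(n) = (-1)^(m+1) Σ_k C(p,k) (-1)^k a_(k+m+1);
--   * n ≤ m:      upper negation binom(-(q+1),k) = (-1)^k C(q+k,k) with q = m-n, and
--                 C(m,n)C(n,k)/C(m,k) = C(m-k,n-k), give, after reflecting k ↦ n-k,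
--                 L(n) = (-1)^n C(m,n) Σ_k C(n,k) a_k / C(m,k).
-- In both cases L(n) is a unit times the other sum, so the identities are equivalent
-- pointwise (unit-transfer), and splitting ℕ at m yields the theorem.

open import Defs
open import Algebra.Bundles using (CommutativeRing)
open import Data.Nat using (ℕ; zero; suc; _∸_; _≤_; _<_; _!; z≤n; s≤s)
import Data.Nat as N
import Data.Nat.Properties as NP
open import Data.Nat.Combinatorics using (_C_; k>n⇒nCk≡0; nCk≡nC[n∸k])
open import Data.Sum using (_⊎_)
open import Data.Product using (_×_; _,_)
open import Function.Bundles using (_⇔_; mk⇔; module Equivalence)
import Relation.Binary.PropositionalEquality as Eq
import Algebra.Properties.Ring as RingProperties
import Algebra.Solver.CommutativeMonoid as CommutativeMonoidSolver
import Relation.Binary.Reasoning.Setoid as SetoidReasoning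

module NatBinomial where

  open import Data.Nat using (ℕ; zero; suc; _+_; _*_; _∸_; _≤_; _≤?_; _!; s≤s; ≢-nonZero⁻¹)
  open import Data.Nat.Properties
  open import Data.Nat.Combinatorics
    using (_C_; nCk≡n!/k![n-k]!; k![n∸k]!∣n!; k>n⇒nCk≡0; nC1≡n; nCk+nC[k+1]≡[n+1]C[k+1])
  open import Data.Nat.DivMod using (m/n*n≡m)
  open import Data.Nat.Solver using (module +-*-Solver)
  open +-*-Solver using (solve; _:*_; _:=_)
  open import Relation.Binary.PropositionalEquality
  open import Relation.Nullary using (yes; no)
  open ≡-Reasoning

  C-fact : ∀ {n k} → k ≤ n → (n C k) * (k ! * (n ∸ k) !) ≡ n !
  C-fact {n} {k} k≤n = trans (cong (_* (k ! * (n ∸ k) !)) (nCk≡n!/k![n-k]! k≤n))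
                             (m/n*n≡m {{k !* (n ∸ k) !≢0}} (k![n∸k]!∣n! k≤n))

  C-absorb : ∀ n k → (suc n C suc k) * suc k ≡ (n C k) * suc n
  C-absorb n k with k ≤? n
  ... | no k≰n = trans (cong (_* suc k) (k>n⇒nCk≡0 (s≤s (≰⇒> k≰n))))
                       (sym (cong (_* suc n) (k>n⇒nCk≡0 (≰⇒> k≰n))))
  ... | yes k≤n = *-cancelʳ-≡ _ _ (k ! * (n ∸ k) !) {{k !* (n ∸ k) !≢0}} (begin
    (suc n C suc k) * suc k * (k ! * (n ∸ k) !)
      ≡⟨ solve 4 (λ c s f g → c :* s :* (f :* g) := c :* (s :* f :* g)) refl
           (suc n C suc k) (suc k) (k !) ((n ∸ k) !) ⟩
    (suc n C suc k) * (suc k ! * (suc n ∸ suc k) !)  ≡⟨ C-fact (s≤s k≤n) ⟩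
    suc n * n !                                     ≡⟨ cong (suc n *_) (C-fact k≤n) ⟨
    suc n * ((n C k) * (k ! * (n ∸ k) !))
      ≡⟨ solve 3 (λ s c f → s :* (c :* f) := c :* s :* f) refl (suc n) (n C k) (k ! * (n ∸ k) !) ⟩
    (n C k) * suc n * (k ! * (n ∸ k) !) ∎)

  -- The recurrence  C(p,k+1)(k+1) + C(p,k) k = C(p,k) p , i.e. C(p,k+1)(k+1) = C(p,k)(p-k)
  -- written without truncated subtraction; it drives the falling factorial of p.
  C-step : ∀ p k → (p C suc k) * suc k + (p C k) * k ≡ (p C k) * p
  C-step zero zero = refl
  C-step zero (suc k) = refl
  C-step (suc n) zero = begin
    (suc n C 1) * 1 + 0  ≡⟨ +-identityʳ _ ⟩
    (suc n C 1) * 1      ≡⟨ *-identityʳ _ ⟩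
    (suc n C 1)          ≡⟨ nC1≡n (suc n) ⟩
    suc n              ≡⟨ *-identityˡ (suc n) ⟨
    1 * suc n          ∎
  C-step (suc n) (suc k) = begin
    (suc n C suc (suc k)) * suc (suc k) + (suc n C suc k) * suc k
      ≡⟨ cong₂ _+_ (C-absorb n (suc k)) (C-absorb n k) ⟩
    (n C suc k) * suc n + (n C k) * suc n  ≡⟨ *-distribʳ-+ (suc n) (n C suc k) (n C k) ⟨
    ((n C suc k) + (n C k)) * suc n        ≡⟨ cong (_* suc n) (+-comm (n C suc k) (n C k)) ⟩
    ((n C k) + (n C suc k)) * suc n        ≡⟨ cong (_* suc n) (nCk+nC[k+1]≡[n+1]C[k+1] n k) ⟩
    (suc n C suc k) * suc n              ∎

  -- Choosing a k-subset of an n-subset of an m-set: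
  --   C(m,n) C(n,j) = C(m,j) C(m-j, n-j)   for j ≤ n ≤ m.
  C-subset : ∀ {m n j} → j ≤ n → n ≤ m → (m C n) * (n C j) ≡ (m C j) * ((m ∸ j) C (n ∸ j))
  C-subset {m} {n} {j} j≤n n≤m =
    *-cancelʳ-≡ _ _ (j ! * (n ∸ j) ! * (m ∸ n) !) {{m*n≢0 _ _ {{j !* (n ∸ j) !≢0}} {{(m ∸ n) !≢0}}}}
      (trans left (sym right))
    where
    [m∸j]∸[n∸j]≡m∸n : (m ∸ j) ∸ (n ∸ j) ≡ m ∸ n
    [m∸j]∸[n∸j]≡m∸n = trans (∸-+-assoc m j (n ∸ j)) (cong (m ∸_) (m+[n∸m]≡n j≤n))
    left : (m C n) * (n C j) * (j ! * (n ∸ j) ! * (m ∸ n) !) ≡ m !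
    left = begin
      (m C n) * (n C j) * (j ! * (n ∸ j) ! * (m ∸ n) !)
        ≡⟨ solve 5 (λ a b c d e → a :* b :* (c :* d :* e) := a :* (b :* (c :* d) :* e)) refl
             (m C n) (n C j) (j !) ((n ∸ j) !) ((m ∸ n) !) ⟩
      (m C n) * ((n C j) * (j ! * (n ∸ j) !) * (m ∸ n) !)
        ≡⟨ cong (λ t → (m C n) * (t * (m ∸ n) !)) (C-fact j≤n) ⟩
      (m C n) * (n ! * (m ∸ n) !)  ≡⟨ C-fact n≤m ⟩
      m ! ∎
    right : (m C j) * ((m ∸ j) C (n ∸ j)) * (j ! * (n ∸ j) ! * (m ∸ n) !) ≡ m !
    right = begin
      (m C j) * ((m ∸ j) C (n ∸ j)) * (j ! * (n ∸ j) ! * (m ∸ n) !)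
        ≡⟨ solve 5 (λ a b c d e → a :* b :* (c :* d :* e) := a :* (c :* (b :* (d :* e)))) refl
             (m C j) ((m ∸ j) C (n ∸ j)) (j !) ((n ∸ j) !) ((m ∸ n) !) ⟩
      (m C j) * (j ! * (((m ∸ j) C (n ∸ j)) * ((n ∸ j) ! * (m ∸ n) !)))
        ≡⟨ cong (λ t → (m C j) * (j ! * (((m ∸ j) C (n ∸ j)) * ((n ∸ j) ! * t !)))) [m∸j]∸[n∸j]≡m∸n ⟨
      (m C j) * (j ! * (((m ∸ j) C (n ∸ j)) * ((n ∸ j) ! * ((m ∸ j) ∸ (n ∸ j)) !)))
        ≡⟨ cong (λ t → (m C j) * (j ! * t)) (C-fact (∸-monoˡ-≤ j n≤m)) ⟩
      (m C j) * (j ! * (m ∸ j) !)  ≡⟨ C-fact (≤-trans j≤n n≤m) ⟩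
      m ! ∎

  C-nonzero : ∀ {n k} → k ≤ n → n C k ≢ 0
  C-nonzero {n} {k} k≤n C≡0 = ≢-nonZero⁻¹ (n !) {{n !≢0}}
    (trans (sym (C-fact k≤n)) (cong (_* (k ! * (n ∸ k) !)) C≡0))

  reflect-shifted : ∀ {p k} s → k ≤ p → (p + s) ∸ (p ∸ k) ≡ k + s
  reflect-shifted {p} {k} s k≤p = trans (+-∸-comm s (m∸n≤m p k)) (cong (_+ s) (m∸[m∸n]≡n k≤p))

  gap-split : ∀ {m n k} → k ≤ n → n ≤ m → (m ∸ n) + (n ∸ k) ≡ m ∸ k
  gap-split {m} {n} {k} k≤n n≤m =
    sym (trans (cong (_∸ k) (sym (m∸n+n≡m n≤m))) (+-∸-assoc (m ∸ n) k≤n))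

  split-at : ∀ {ℓ} (P : ℕ → Set ℓ) m → (∀ n → n ≤ m → P n) → (∀ p → P (p + suc m)) → ∀ n → P n
  split-at P m below beyond n with n ≤? m
  ... | yes n≤m = below n n≤m
  ... | no n≰m = subst P (m∸n+n≡m (≰⇒> n≰m)) (beyond (n ∸ suc m))

open NatBinomial using (C-absorb; C-step; C-subset; C-nonzero; reflect-shifted; gap-split)

module RingFacts {r ℓ} (R : CommutativeRing r ℓ) where
  open CommutativeRing R
  open WithRing R
  open SetoidReasoning setoid
  open RingProperties ring using (-1*x≈-x; -‿involutive; -‿+-comm; x[y-z]≈xy-xz)
  open CommutativeMonoidSolver *-commutativeMonoid using (solve; _⊕_; _⊜_)

  ι-+ : ∀ a b → ι (a N.+ b) ≈ ι a + ι b
  ι-+ zero b = sym (+-identityˡ _)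
  ι-+ (suc a) b = trans (+-congˡ (ι-+ a b)) (sym (+-assoc _ _ _))

  ι-* : ∀ a b → ι (a N.* b) ≈ ι a * ι b
  ι-* zero b = sym (zeroˡ _)
  ι-* (suc a) b = begin
    ι (b N.+ a N.* b)        ≈⟨ trans (ι-+ b (a N.* b)) (+-congˡ (ι-* a b)) ⟩
    ι b + ι a * ι b          ≈⟨ +-congʳ (*-identityˡ (ι b)) ⟨
    1# * ι b + ι a * ι b     ≈⟨ distribʳ (ι b) 1# (ι a) ⟨
    (1# + ι a) * ι b         ∎

  ι-1 : ι 1 ≈ 1#
  ι-1 = +-identityʳ 1#

  negOnePow-+ : ∀ a b → negOnePow (a N.+ b) ≈ negOnePow a * negOnePow b
  negOnePow-+ zero b = sym (*-identityˡ _)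
  negOnePow-+ (suc a) b = trans (*-congˡ (negOnePow-+ a b)) (sym (*-assoc _ _ _))

  negOnePow-square : ∀ a → negOnePow a * negOnePow a ≈ 1#
  negOnePow-square zero = *-identityˡ 1#
  negOnePow-square (suc a) = begin
    (- 1# * negOnePow a) * (- 1# * negOnePow a)
      ≈⟨ solve 2 (λ x y → ((x ⊕ y) ⊕ (x ⊕ y)) ⊜ ((x ⊕ x) ⊕ (y ⊕ y))) refl (- 1#) (negOnePow a) ⟩
    (- 1# * - 1#) * (negOnePow a * negOnePow a)
      ≈⟨ *-cong (trans (-1*x≈-x (- 1#)) (-‿involutive 1#)) (negOnePow-square a) ⟩
    1# * 1#  ≈⟨ *-identityˡ 1# ⟩
    1#       ∎

  subtract-right : ∀ {x y z} → x ≈ y + z → x - z ≈ y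
  subtract-right {x} {y} {z} x≈y+z = begin
    x - z        ≈⟨ +-congʳ x≈y+z ⟩
    (y + z) - z  ≈⟨ +-assoc y z (- z) ⟩
    y + (z - z)  ≈⟨ +-congˡ (-‿inverseʳ z) ⟩
    y + 0#       ≈⟨ +-identityʳ y ⟩
    y            ∎

  -- x - (y + x) = -y; used to rewrite the upper argument n - (m+1) as -(m-n+1).
  difference-of-shift : ∀ x y → x - (y + x) ≈ - y
  difference-of-shift x y = begin
    x - (y + x)      ≈⟨ +-congˡ (-‿+-comm y x) ⟨
    x + (- y - x)    ≈⟨ +-congˡ (+-comm (- y) (- x)) ⟩
    x + (- x - y)    ≈⟨ +-assoc x (- x) (- y) ⟨
    (x - x) - y      ≈⟨ +-congʳ (-‿inverseʳ x) ⟩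
    0# - y           ≈⟨ +-identityˡ (- y) ⟩
    - y              ∎

  cancel-unit : ∀ {t s y z} → t * s ≈ 1# → y * t ≈ z * t → y ≈ z
  cancel-unit {t} {s} {y} {z} ts≈1 yt≈zt = begin
    y              ≈⟨ *-identityʳ y ⟨
    y * 1#         ≈⟨ *-congˡ ts≈1 ⟨
    y * (t * s)    ≈⟨ *-assoc y t s ⟨
    (y * t) * s    ≈⟨ *-congʳ yt≈zt ⟩
    (z * t) * s    ≈⟨ *-assoc z t s ⟩
    z * (t * s)    ≈⟨ *-congˡ ts≈1 ⟩
    z * 1#         ≈⟨ *-identityʳ z ⟩
    z              ∎

  unit-transfer : ∀ {u v X Y w w′} → u * v ≈ 1# → X ≈ u * Y → v * w ≈ w′ → (X ≈ w ⇔ Y ≈ w′)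
  unit-transfer {u} {v} {X} {Y} {w} {w′} uv≈1 X≈uY vw≈w′ = mk⇔ forward backward
    where
    forward : X ≈ w → Y ≈ w′
    forward X≈w = begin
      Y            ≈⟨ *-identityˡ Y ⟨
      1# * Y       ≈⟨ *-congʳ (trans (*-comm v u) uv≈1) ⟨
      (v * u) * Y  ≈⟨ *-assoc v u Y ⟩
      v * (u * Y)  ≈⟨ *-congˡ (trans (sym X≈uY) X≈w) ⟩
      v * w        ≈⟨ vw≈w′ ⟩
      w′           ∎
    backward : Y ≈ w′ → X ≈ w
    backward Y≈w′ = begin
      X            ≈⟨ X≈uY ⟩
      u * Y        ≈⟨ *-congˡ (trans Y≈w′ (sym vw≈w′)) ⟩
      u * (v * w)  ≈⟨ *-assoc u v w ⟨
      (u * v) * w  ≈⟨ *-congʳ uv≈1 ⟩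
      1# * w       ≈⟨ *-identityˡ w ⟩
      w            ∎

  sumTo-cong : ∀ n {f g} → (∀ k → k ≤ n → f k ≈ g k) → sumTo n f ≈ sumTo n g
  sumTo-cong zero f≈g = f≈g 0 z≤n
  sumTo-cong (suc n) f≈g =
    +-cong (sumTo-cong n (λ k k≤n → f≈g k (NP.m≤n⇒m≤1+n k≤n))) (f≈g (suc n) NP.≤-refl)

  sumTo-scale : ∀ n x f → x * sumTo n f ≈ sumTo n (λ k → x * f k)
  sumTo-scale zero x f = refl
  sumTo-scale (suc n) x f = trans (distribˡ x _ _) (+-congʳ (sumTo-scale n x f))

  sumTo-unfoldˡ : ∀ n f → sumTo (suc n) f ≈ f 0 + sumTo n (λ k → f (suc k))
  sumTo-unfoldˡ zero f = refl
  sumTo-unfoldˡ (suc n) f = trans (+-congʳ (sumTo-unfoldˡ n f)) (+-assoc _ _ _)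

  sumTo-reflect : ∀ n f → sumTo n f ≈ sumTo n (λ k → f (n ∸ k))
  sumTo-reflect zero f = refl
  sumTo-reflect (suc n) f = trans (+-congʳ (sumTo-reflect n f))
    (trans (+-comm _ _) (sym (sumTo-unfoldˡ n (λ k → f (suc n ∸ k)))))

  sumTo-truncate : ∀ p j f → (∀ k → p < k → f k ≈ 0#) → sumTo (j N.+ p) f ≈ sumTo p f
  sumTo-truncate p zero f vanish = refl
  sumTo-truncate p (suc j) f vanish =
    trans (+-cong (sumTo-truncate p j f vanish) (vanish (suc (j N.+ p)) (s≤s (NP.m≤n+m p j))))
          (+-identityʳ _)

  module GeneralizedBinomial (invN : ℕ → Carrier) (invertible : IsNatInverse invN) where

    inverse-fact : ∀ k → ι (k !) * invN (k !) ≈ 1#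
    inverse-fact k = invertible (k !) (N.≢-nonZero⁻¹ (k !) {{NP._!≢0 k}})

    inverse-fact-suc : ∀ k → invN (suc k !) * ι (suc k) ≈ invN (k !)
    inverse-fact-suc k = begin
      i′ * t              ≈⟨ *-identityʳ (i′ * t) ⟨
      i′ * t * 1#         ≈⟨ *-congˡ (inverse-fact k) ⟨
      i′ * t * (f * i)    ≈⟨ solve 4 (λ x y z w → ((x ⊕ y) ⊕ (z ⊕ w)) ⊜ ((x ⊕ (y ⊕ z)) ⊕ w)) refl i′ t f i ⟩
      i′ * (t * f) * i    ≈⟨ *-congʳ (*-congˡ (ι-* (suc k) (k !))) ⟨
      i′ * ι (suc k !) * i ≈⟨ *-congʳ (trans (*-comm _ _) (inverse-fact (suc k))) ⟩
      1# * i              ≈⟨ *-identityˡ i ⟩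
      i                   ∎
      where
      i′ = invN (suc k !)
      t = ι (suc k)
      f = ι (k !)
      i = invN (k !)

    binom-cong : ∀ {x y} k → x ≈ y → binom invN x k ≈ binom invN y k
    binom-cong {x} {y} k x≈y = *-congʳ (ff-cong k)
      where
      ff-cong : ∀ k → ff x k ≈ ff y k
      ff-cong zero = refl
      ff-cong (suc k) = *-cong (ff-cong k) (+-congʳ x≈y)

    binom-zero : ∀ x → binom invN x 0 ≈ 1#
    binom-zero x = trans (*-congʳ (sym ι-1)) (invertible 1 (λ ()))

    binom-suc : ∀ x k → binom invN x (suc k) * ι (suc k) ≈ binom invN x k * (x - ι k)
    binom-suc x k = begin
      ff x k * (x - ι k) * invN (suc k !) * ι (suc k)
        ≈⟨ *-assoc _ _ _ ⟩
      ff x k * (x - ι k) * (invN (suc k !) * ι (suc k))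
        ≈⟨ *-congˡ (inverse-fact-suc k) ⟩
      ff x k * (x - ι k) * invN (k !)
        ≈⟨ solve 3 (λ u v w → ((u ⊕ v) ⊕ w) ⊜ ((u ⊕ w) ⊕ v)) refl (ff x k) (x - ι k) (invN (k !)) ⟩
      ff x k * invN (k !) * (x - ι k) ∎

    -- Since positive integers are invertible, the recurrence determines binom x.
    binom-unique : ∀ x (c : ℕ → Carrier) → c 0 ≈ 1# →
                   (∀ k → c (suc k) * ι (suc k) ≈ c k * (x - ι k)) →
                   ∀ k → c k ≈ binom invN x k
    binom-unique x c c₀ step zero = trans c₀ (sym (binom-zero x))
    binom-unique x c c₀ step (suc k) = cancel-unit (invertible (suc k) (λ ())) (begin
      c (suc k) * ι (suc k)            ≈⟨ step k ⟩
      c k * (x - ι k)                  ≈⟨ *-congʳ (binom-unique x c c₀ step k) ⟩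
      binom invN x k * (x - ι k)       ≈⟨ binom-suc x k ⟨
      binom invN x (suc k) * ι (suc k) ∎)

    binom-natural : ∀ p k → binom invN (ι p) k ≈ ι (p C k)
    binom-natural p k = sym (binom-unique (ι p) (λ k → ι (p C k)) ι-1 step k)
      where
      step : ∀ k → ι (p C suc k) * ι (suc k) ≈ ι (p C k) * (ι p - ι k)
      step k = begin
        ι (p C suc k) * ι (suc k)               ≈⟨ subtract-right lifted ⟨
        ι (p C k) * ι p - ι (p C k) * ι k       ≈⟨ x[y-z]≈xy-xz (ι (p C k)) (ι p) (ι k) ⟨
        ι (p C k) * (ι p - ι k)                 ∎
        where
        lifted : ι (p C k) * ι p ≈ ι (p C suc k) * ι (suc k) + ι (p C k) * ι k
        lifted = begin
          ι (p C k) * ι p                                   ≈⟨ ι-* (p C k) p ⟨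
          ι ((p C k) N.* p)                                 ≈⟨ reflexive (Eq.cong ι (C-step p k)) ⟨
          ι ((p C suc k) N.* suc k N.+ (p C k) N.* k)       ≈⟨ ι-+ ((p C suc k) N.* suc k) ((p C k) N.* k) ⟩
          ι ((p C suc k) N.* suc k) + ι ((p C k) N.* k)     ≈⟨ +-cong (ι-* (p C suc k) (suc k)) (ι-* (p C k) k) ⟩
          ι (p C suc k) * ι (suc k) + ι (p C k) * ι k       ∎

    binom-negative : ∀ q k → binom invN (- ι (suc q)) k ≈ negOnePow k * ι ((q N.+ k) C k)
    binom-negative q k = sym (binom-unique (- ι (suc q)) c (trans (*-identityˡ _) ι-1) step k)
      where
      c : ℕ → Carrier
      c k = negOnePow k * ι ((q N.+ k) C k)
      absorbed : ∀ k → ι ((q N.+ suc k) C suc k) * ι (suc k) ≈ ι ((q N.+ k) C k) * ι (suc (q N.+ k))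
      absorbed k = begin
        ι ((q N.+ suc k) C suc k) * ι (suc k)       ≈⟨ ι-* ((q N.+ suc k) C suc k) (suc k) ⟨
        ι (((q N.+ suc k) C suc k) N.* suc k)       ≈⟨ reflexive (Eq.cong ι (Eq.trans
             (Eq.cong (λ t → (t C suc k) N.* suc k) (NP.+-suc q k)) (C-absorb (q N.+ k) k))) ⟩
        ι (((q N.+ k) C k) N.* suc (q N.+ k))       ≈⟨ ι-* ((q N.+ k) C k) (suc (q N.+ k)) ⟩
        ι ((q N.+ k) C k) * ι (suc (q N.+ k))       ∎
      shifted : ∀ k → - ι (suc q) - ι k ≈ - 1# * ι (suc (q N.+ k))
      shifted k = trans (-‿+-comm (ι (suc q)) (ι k))
                        (trans (-‿cong (sym (ι-+ (suc q) k))) (sym (-1*x≈-x _)))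
      step : ∀ k → c (suc k) * ι (suc k) ≈ c k * (- ι (suc q) - ι k)
      step k = begin
        - 1# * s * ι E * ι (suc k)          ≈⟨ *-assoc (- 1# * s) (ι E) (ι (suc k)) ⟩
        - 1# * s * (ι E * ι (suc k))        ≈⟨ *-congˡ (absorbed k) ⟩
        - 1# * s * (ι D * ι (suc (q N.+ k)))
          ≈⟨ solve 4 (λ x y z w → ((x ⊕ y) ⊕ (z ⊕ w)) ⊜ ((y ⊕ z) ⊕ (x ⊕ w))) refl (- 1#) s (ι D) (ι (suc (q N.+ k))) ⟩
        s * ι D * (- 1# * ι (suc (q N.+ k))) ≈⟨ *-congˡ (shifted k) ⟨
        s * ι D * (- ι (suc q) - ι k)       ∎
        where
        s = negOnePow k
        D = (q N.+ k) C k
        E = (q N.+ suc k) C suc k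

    binomial-ratio : ∀ {m n k} → k ≤ n → n ≤ m →
                     ι (m C n) * ι (n C k) * invN (m C k) ≈ ι ((m ∸ k) C (n ∸ k))
    binomial-ratio {m} {n} {k} k≤n n≤m = begin
      ι (m C n) * ι (n C k) * i             ≈⟨ *-congʳ (ι-* (m C n) (n C k)) ⟨
      ι ((m C n) N.* (n C k)) * i           ≈⟨ *-congʳ (reflexive (Eq.cong ι (C-subset k≤n n≤m))) ⟩
      ι ((m C k) N.* D) * i                 ≈⟨ *-congʳ (ι-* (m C k) D) ⟩
      ι (m C k) * ι D * i                   ≈⟨ solve 3 (λ x y z → ((x ⊕ y) ⊕ z) ⊜ (y ⊕ (x ⊕ z))) refl (ι (m C k)) (ι D) i ⟩
      ι D * (ι (m C k) * i)                 ≈⟨ *-congˡ (invertible (m C k) (C-nonzero (NP.≤-trans k≤n n≤m))) ⟩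
      ι D * 1#                              ≈⟨ *-identityʳ (ι D) ⟩
      ι D                                   ∎
      where
      i = invN (m C k)
      D = (m ∸ k) C (n ∸ k)

    module Sums (m : ℕ) (a : ℕ → Carrier) where

      reciprocity : ℕ → Carrier
      reciprocity n = sumTo n (λ k → binom invN (ι n - ι (suc m)) k * negOnePow (n ∸ k) * a (n ∸ k))

      lowSum : ℕ → Carrier
      lowSum n = sumTo n (λ k → ι (n C k) * (a k * invN (m C k)))

      highSum : ℕ → Carrier
      highSum n = sumTo n (λ k → ι (n C k) * negOnePow k * a (k N.+ suc m))

      -- Beyond m the upper argument n-m-1 = p is a natural number, so only the
      -- first p+1 terms survive; reflecting them gives the binomial transform.
      reciprocity-high : ∀ p → reciprocity (p N.+ suc m) ≈ negOnePow (suc m) * highSum p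
      reciprocity-high p = begin
        reciprocity n                   ≈⟨ sumTo-cong n (λ k _ → *-congʳ (*-congʳ (natural k))) ⟩
        sumTo n g                       ≈⟨ reflexive (Eq.cong (λ t → sumTo t g) (NP.+-comm p (suc m))) ⟩
        sumTo (suc m N.+ p) g           ≈⟨ sumTo-truncate p (suc m) g vanish ⟩
        sumTo p g                       ≈⟨ sumTo-reflect p g ⟩
        sumTo p (λ k → g (p ∸ k))       ≈⟨ sumTo-cong p reflected ⟩
        sumTo p (λ k → s * (ι (p C k) * negOnePow k * a (k N.+ suc m))) ≈⟨ sumTo-scale p s _ ⟨
        s * highSum p                   ∎
        where
        n = p N.+ suc m
        s = negOnePow (suc m)
        g : ℕ → Carrier
        g k = ι (p C k) * negOnePow (n ∸ k) * a (n ∸ k)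
        natural : ∀ k → binom invN (ι n - ι (suc m)) k ≈ ι (p C k)
        natural k = trans (binom-cong k (subtract-right (ι-+ p (suc m)))) (binom-natural p k)
        vanish : ∀ k → p < k → g k ≈ 0#
        vanish k p<k = begin
          ι (p C k) * negOnePow (n ∸ k) * a (n ∸ k) ≈⟨ *-congʳ (*-congʳ (reflexive (Eq.cong ι (k>n⇒nCk≡0 p<k)))) ⟩
          0# * negOnePow (n ∸ k) * a (n ∸ k)        ≈⟨ trans (*-congʳ (zeroˡ _)) (zeroˡ _) ⟩
          0#                                        ∎
        reflected : ∀ k → k ≤ p → g (p ∸ k) ≈ s * (ι (p C k) * negOnePow k * a (k N.+ suc m))
        reflected k k≤p = begin
          ι (p C (p ∸ k)) * negOnePow (n ∸ (p ∸ k)) * a (n ∸ (p ∸ k))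
            ≈⟨ reflexive (Eq.cong₂ (λ u v → ι u * negOnePow v * a v)
                 (Eq.sym (nCk≡nC[n∸k] k≤p)) (reflect-shifted (suc m) k≤p)) ⟩
          ι (p C k) * negOnePow (k N.+ suc m) * a (k N.+ suc m)
            ≈⟨ *-congʳ (*-congˡ (negOnePow-+ k (suc m))) ⟩
          ι (p C k) * (negOnePow k * s) * a (k N.+ suc m)
            ≈⟨ solve 4 (λ x y z w → ((x ⊕ (y ⊕ z)) ⊕ w) ⊜ (z ⊕ ((x ⊕ y) ⊕ w))) refl
                 (ι (p C k)) (negOnePow k) s (a (k N.+ suc m)) ⟩
          s * (ι (p C k) * negOnePow k * a (k N.+ suc m)) ∎

      -- Up to m the upper argument is the negative integer -(m-n+1); reflecting the
      -- sum and using binomial-ratio matches it termwise with C(m,n) · lowSum.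
      reciprocity-low : ∀ n → n ≤ m → reciprocity n ≈ (negOnePow n * ι (m C n)) * lowSum n
      reciprocity-low n n≤m = begin
        reciprocity n                   ≈⟨ sumTo-reflect n f ⟩
        sumTo n (λ k → f (n ∸ k))       ≈⟨ sumTo-cong n reflected ⟩
        sumTo n (λ k → u * (ι (n C k) * (a k * invN (m C k)))) ≈⟨ sumTo-scale n u _ ⟨
        u * lowSum n                    ∎
        where
        q = m ∸ n
        u = negOnePow n * ι (m C n)
        x = ι n - ι (suc m)
        f : ℕ → Carrier
        f k = binom invN x k * negOnePow (n ∸ k) * a (n ∸ k)
        negative : x ≈ - ι (suc q)
        negative = begin
          ι n - ι (suc m)           ≈⟨ +-congˡ (-‿cong (reflexive (Eq.cong (λ t → ι (suc t)) (Eq.sym (NP.m∸n+n≡m n≤m))))) ⟩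
          ι n - ι (suc q N.+ n)     ≈⟨ +-congˡ (-‿cong (ι-+ (suc q) n)) ⟩
          ι n - (ι (suc q) + ι n)   ≈⟨ difference-of-shift (ι n) (ι (suc q)) ⟩
          - ι (suc q)               ∎
        reflected : ∀ k → k ≤ n → f (n ∸ k) ≈ u * (ι (n C k) * (a k * invN (m C k)))
        reflected k k≤n = begin
          binom invN x j * negOnePow (n ∸ j) * a (n ∸ j)
            ≈⟨ reflexive (Eq.cong (λ t → binom invN x j * negOnePow t * a t) (NP.m∸[m∸n]≡n k≤n)) ⟩
          binom invN x j * negOnePow k * a k
            ≈⟨ *-congʳ (*-congʳ (trans (binom-cong j negative) (binom-negative q j))) ⟩
          negOnePow j * ι ((q N.+ j) C j) * negOnePow k * a k
            ≈⟨ reflexive (Eq.cong (λ t → negOnePow j * ι (t C j) * negOnePow k * a k) (gap-split k≤n n≤m)) ⟩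
          negOnePow j * ι D * negOnePow k * a k
            ≈⟨ solve 4 (λ w y z v → (((w ⊕ y) ⊕ z) ⊕ v) ⊜ ((w ⊕ z) ⊕ (y ⊕ v))) refl (negOnePow j) (ι D) (negOnePow k) (a k) ⟩
          negOnePow j * negOnePow k * (ι D * a k)
            ≈⟨ *-congʳ (trans (sym (negOnePow-+ j k)) (reflexive (Eq.cong negOnePow (NP.m∸n+n≡m k≤n)))) ⟩
          negOnePow n * (ι D * a k)
            ≈⟨ *-congˡ (*-congʳ (binomial-ratio k≤n n≤m)) ⟨
          negOnePow n * (ι (m C n) * ι (n C k) * invN (m C k) * a k)
            ≈⟨ solve 5 (λ s y z i v → (s ⊕ (((y ⊕ z) ⊕ i) ⊕ v)) ⊜ ((s ⊕ y) ⊕ (z ⊕ (v ⊕ i)))) refl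
                 (negOnePow n) (ι (m C n)) (ι (n C k)) (invN (m C k)) (a k) ⟩
          u * (ι (n C k) * (a k * invN (m C k))) ∎
          where
          j = n ∸ k
          D = (m ∸ k) C (n ∸ k)

      -- Pointwise form of the theorem beyond m: (-1)^(m+1) is its own inverse.
      high-equivalence : ∀ ε p → (reciprocity (p N.+ suc m) ≈ ε * a (p N.+ suc m))
                                 ⇔ (highSum p ≈ ε * negOnePow (suc m) * a (p N.+ suc m))
      high-equivalence ε p = unit-transfer (negOnePow-square (suc m)) (reciprocity-high p)
        (solve 3 (λ s e x → (s ⊕ (e ⊕ x)) ⊜ ((e ⊕ s) ⊕ x)) refl (negOnePow (suc m)) ε (a (p N.+ suc m)))

      -- Pointwise form of the theorem up to m: (-1)^n C(m,n) has inverse (-1)^n / C(m,n).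
      low-equivalence : ∀ ε n → n ≤ m → (reciprocity n ≈ ε * a n)
                                        ⇔ (lowSum n ≈ ε * negOnePow n * (a n * invN (m C n)))
      low-equivalence ε n n≤m = unit-transfer unit (reciprocity-low n n≤m)
        (solve 4 (λ s i e x → ((s ⊕ i) ⊕ (e ⊕ x)) ⊜ ((e ⊕ s) ⊕ (x ⊕ i))) refl (negOnePow n) (invN (m C n)) ε (a n))
        where
        unit : negOnePow n * ι (m C n) * (negOnePow n * invN (m C n)) ≈ 1#
        unit = begin
          negOnePow n * ι (m C n) * (negOnePow n * invN (m C n))
            ≈⟨ solve 3 (λ s c i → ((s ⊕ c) ⊕ (s ⊕ i)) ⊜ ((s ⊕ s) ⊕ (c ⊕ i))) refl (negOnePow n) (ι (m C n)) (invN (m C n)) ⟩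
          negOnePow n * negOnePow n * (ι (m C n) * invN (m C n))
            ≈⟨ *-cong (negOnePow-square n) (invertible (m C n) (C-nonzero n≤m)) ⟩
          1# * 1#  ≈⟨ *-identityˡ 1# ⟩
          1#       ∎

open NatBinomial using (split-at)

-- Theorem 2.4: for n ≤ m the reciprocity identity at n is equivalent to the first
-- condition at n, and at n = p+m+1 to the second condition at p.
theorem2p4 : ∀ {c ℓ} (R : CommutativeRing c ℓ) →
    let open CommutativeRing R in let open WithRing R in
    (invN : ℕ → Carrier) → IsNatInverse invN →
    (m : ℕ) (a : ℕ → Carrier) (ε : Carrier) → (ε ≈ 1# ⊎ ε ≈ - 1#) →
    ((∀ n → sumTo n (λ k → binom invN (ι n - ι (suc m)) k * negOnePow (n ∸ k) * a (n ∸ k)) ≈ ε * a n)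
    ⇔
    ((∀ n → n ≤ m → sumTo n (λ k → ι (n C k) * (a k * invN (m C k))) ≈ ε * negOnePow n * (a n * invN (m C n)))
    ×
    (∀ n → sumTo n (λ k → ι (n C k) * negOnePow k * a (k N.+ suc m)) ≈ ε * negOnePow (suc m) * a (n N.+ suc m))))
theorem2p4 R invN invertible m a ε _ = mk⇔
  (λ reciprocal → (λ n n≤m → to (low-equivalence ε n n≤m) (reciprocal n))
                 , (λ p → to (high-equivalence ε p) (reciprocal (p N.+ suc m))))
  (λ (low , high) → split-at (λ n → reciprocity n ≈ ε * a n) m
                      (λ n n≤m → from (low-equivalence ε n n≤m) (low n n≤m))
                      (λ p → from (high-equivalence ε p) (high p)))
  where
  open CommutativeRing R using (_≈_; _*_)
  open RingFacts R
  open GeneralizedBinomial invN invertible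
  open Sums m a
  open Equivalence
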